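{- (1) The hypersequent calculus $\mathbf{HLJ}'+(\mathrm{rs})$ proves $\mathsf{LIN}$, i.e. for all propositional formulas $\varphi,\psi$ it derives the hypersequent $\Rightarrow(\varphi\to\psi)\lor(\psi\to\varphi)$. (2) The hypersequent calculus $\forall\mathbf{HLJ}'+(\forall\text{ - }\mathrm{R_{ms}})+(\mathrm{rs})$ proves $\mathsf{ACD}$, i.e. for all formulas $\varphi,\psi(x)$ with $x$ not free in $\varphi$ it derives the hypersequent $\Rightarrow\forall x(\varphi\lor\psi(x))\to\varphi\lor\forall x\psi(x)$.
   Context: Formulas are built from atoms and $\bot$ with $\land,\lor,\to$ (and, in the predicate case, $\forall,\exists$ over a first-order language). A sequent $\Gamma\Rightarrow\Delta$ consists of finite sequences $\Gamma,\Delta$ of formulas; a hypersequent is a finite sequence of sequents, written $\Gamma_1\Rightarrow\Delta_1\mid\cdots\mid\Gamma_n\Rightarrow\Delta_n$. $G,H$ denote possibly empty hypersequents, $S,T$ sequents, and $G\mid H$ concatenation. The calculus $\mathbf{HLK}$ has: axioms $\varphi\Rightarrow\varphi$ and $\bot\Rightarrow\varphi$; external rules: from $G$ infer $S\mid G$ (ew); from $S\mid S\mid G$ infer $S\mid G$ (ec); from $G\mid S\mid T\mid H$ infer $G\mid T\mid S\mid H$ (ee); internal rules: from $\Gamma\Rightarrow\Delta\mid G$ infer $\varphi,\Gamma\Rightarrow\Delta\mid G$ and $\Gamma\Rightarrow\Delta,\psi\mid G$ (weakening); from $\varphi,\varphi,\Gamma\Rightarrow\Delta\mid G$ infer $\varphi,\Gamma\Rightarrow\Delta\mid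 G$ and from $\Gamma\Rightarrow\Delta,\psi,\psi\mid G$ infer $\Gamma\Rightarrow\Delta,\psi\mid G$ (contraction); exchange of two adjacent formulas in the antecedent or succedent of a component; cut: from $\Gamma_0\Rightarrow\Delta_0,\delta\mid G$ and $\delta,\Gamma_1\Rightarrow\Delta_1\mid G$ infer $\Gamma_0,\Gamma_1\Rightarrow\Delta_0,\Delta_1\mid G$; logical rules: from $\varphi_i,\Gamma\Rightarrow\Delta\mid G$ infer $\varphi_1\land\varphi_2,\Gamma\Rightarrow\Delta\mid G$ ($i=1,2$); from $\Gamma\Rightarrow\Delta,\varphi_1\mid G$ and $\Gamma\Rightarrow\Delta,\varphi_2\mid G$ infer $\Gamma\Rightarrow\Delta,\varphi_1\land\varphi_2\mid G$; from $\varphi_1,\Gamma\Rightarrow\Delta\mid G$ and $\varphi_2,\Gamma\Rightarrow\Delta\mid G$ infer $\varphi_1\lor\varphi_2,\Gamma\Rightarrow\Delta\mid G$; from $\Gamma\Rightarrow\Delta,\varphi_i\mid G$ infer $\Gamma\Rightarrow\Delta,\varphi_1\lor\varphi_2\mid G$; from $\Gamma\Rightarrow\Delta,\varphi\mid G$ and $\psi,\Gamma\Rightarrow\Delta\mid G$ infer $\varphi\to\psi,\Gamma\Rightarrow\Delta\mid G$; from $\varphi,\Gamma\Rightarrow\Delta,\psi\mid G$ infer $\Gamma\Rightarrow\Delta,\varphi\to\psi\mid G$. $\mathbf{HLJ}'$ is $\mathbf{HLK}$ with the last ($\to$-right) rule replaced by: from $\varphi,\Gamma\Rightarrow\psi\mid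 G$ infer $\Gamma\Rightarrow\varphi\to\psi\mid G$. $\forall\mathbf{HLJ}'$ is $\mathbf{HLJ}'$ plus the quantifier rules: from $[t/x]\varphi,\Gamma\Rightarrow\Delta\mid G$ infer $\forall x\varphi,\Gamma\Rightarrow\Delta\mid G$; from $\Gamma\Rightarrow\varphi$ infer $\Gamma\Rightarrow\forall x\varphi$ (single component, $x$ not free in $\Gamma$); from $\varphi,\Gamma\Rightarrow\Delta$ infer $\exists x\varphi,\Gamma\Rightarrow\Delta$ (single component, $x$ not free in $\Gamma,\Delta$); from $\Gamma\Rightarrow\Delta,[t/x]\psi\mid G$ infer $\Gamma\Rightarrow\Delta,\exists x\psi\mid G$. Additional rules: $(\forall\text{ - }\mathrm{R_{ms}})$: from $\Gamma\Rightarrow\varphi\mid G$ infer $\Gamma\Rightarrow\forall x\varphi\mid G$, provided $x$ is not free in the conclusion. $(\mathrm{rs})$ (right split): from $\Gamma\Rightarrow\Delta_1,\Delta_2\mid G$ infer $\Gamma\Rightarrow\Delta_1\mid\Gamma\Rightarrow\Delta_2\mid G$. -}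

module Defs where

open import Data.Nat using (ℕ; zero; suc)
open import Data.List using (List; []; _∷_; _++_; map)
open import Data.Vec using (Vec) renaming ([] to []ᵥ; _∷_ to _∷ᵥ_)

infixr 9 _∧̇_
infixr 8 _∨̇_
infixr 7 _⇒̇_
infix  3 _⇒_

-- G | H is list concatenation.

record Sequent (F : Set) : Set where
  constructor _⇒_
  field
    ant : List F
    suc' : List F

Hyper : Set → Set
Hyper F = List (Sequent F)

data PForm : Set where
  atom : ℕ → PForm
  ⊥̇    : PForm
  _∧̇_  : PForm → PForm → PForm
  _∨̇_  : PForm → PForm → PForm
  _⇒̇_  : PForm → PForm → PForm

-- Internal rules act on the first component; (ee) permutes components.
-- Antecedent principal formulas are written at the front, succedent
-- principal formulas at the end (Δ ++ ψ ∷ []), as in the paper.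
data HLJ'rs : Hyper PForm → Set where
  ax    : ∀ φ → HLJ'rs ((φ ∷ [] ⇒ φ ∷ []) ∷ [])
  ax⊥   : ∀ φ → HLJ'rs ((⊥̇ ∷ [] ⇒ φ ∷ []) ∷ [])
  ew    : ∀ {S G} → HLJ'rs G → HLJ'rs (S ∷ G)
  ec    : ∀ {S G} → HLJ'rs (S ∷ S ∷ G) → HLJ'rs (S ∷ G)
  ee    : ∀ {G S T H} → HLJ'rs (G ++ S ∷ T ∷ H) → HLJ'rs (G ++ T ∷ S ∷ H)
  wl    : ∀ {φ Γ Δ G} → HLJ'rs ((Γ ⇒ Δ) ∷ G) → HLJ'rs ((φ ∷ Γ ⇒ Δ) ∷ G)
  wr    : ∀ {ψ Γ Δ G} → HLJ'rs ((Γ ⇒ Δ) ∷ G) → HLJ'rs ((Γ ⇒ Δ ++ ψ ∷ []) ∷ G)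
  cl    : ∀ {φ Γ Δ G} → HLJ'rs ((φ ∷ φ ∷ Γ ⇒ Δ) ∷ G) → HLJ'rs ((φ ∷ Γ ⇒ Δ) ∷ G)
  cr    : ∀ {ψ Γ Δ G} → HLJ'rs ((Γ ⇒ Δ ++ ψ ∷ ψ ∷ []) ∷ G) → HLJ'rs ((Γ ⇒ Δ ++ ψ ∷ []) ∷ G)
  exl   : ∀ {Γ₁ φ ψ Γ₂ Δ G} → HLJ'rs ((Γ₁ ++ φ ∷ ψ ∷ Γ₂ ⇒ Δ) ∷ G)
                            → HLJ'rs ((Γ₁ ++ ψ ∷ φ ∷ Γ₂ ⇒ Δ) ∷ G)
  exr   : ∀ {Γ Δ₁ φ ψ Δ₂ G} → HLJ'rs ((Γ ⇒ Δ₁ ++ φ ∷ ψ ∷ Δ₂) ∷ G)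
                            → HLJ'rs ((Γ ⇒ Δ₁ ++ ψ ∷ φ ∷ Δ₂) ∷ G)
  cut   : ∀ {Γ₀ Δ₀ Γ₁ Δ₁ δ G} → HLJ'rs ((Γ₀ ⇒ Δ₀ ++ δ ∷ []) ∷ G) → HLJ'rs ((δ ∷ Γ₁ ⇒ Δ₁) ∷ G)
                              → HLJ'rs ((Γ₀ ++ Γ₁ ⇒ Δ₀ ++ Δ₁) ∷ G)
  ∧l₁   : ∀ {φ₁ φ₂ Γ Δ G} → HLJ'rs ((φ₁ ∷ Γ ⇒ Δ) ∷ G) → HLJ'rs ((φ₁ ∧̇ φ₂ ∷ Γ ⇒ Δ) ∷ G)
  ∧l₂   : ∀ {φ₁ φ₂ Γ Δ G} → HLJ'rs ((φ₂ ∷ Γ ⇒ Δ) ∷ G) → HLJ'rs ((φ₁ ∧̇ φ₂ ∷ Γ ⇒ Δ) ∷ G)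
  ∧r    : ∀ {φ₁ φ₂ Γ Δ G} → HLJ'rs ((Γ ⇒ Δ ++ φ₁ ∷ []) ∷ G) → HLJ'rs ((Γ ⇒ Δ ++ φ₂ ∷ []) ∷ G)
                          → HLJ'rs ((Γ ⇒ Δ ++ φ₁ ∧̇ φ₂ ∷ []) ∷ G)
  ∨l    : ∀ {φ₁ φ₂ Γ Δ G} → HLJ'rs ((φ₁ ∷ Γ ⇒ Δ) ∷ G) → HLJ'rs ((φ₂ ∷ Γ ⇒ Δ) ∷ G)
                          → HLJ'rs ((φ₁ ∨̇ φ₂ ∷ Γ ⇒ Δ) ∷ G)
  ∨r₁   : ∀ {φ₁ φ₂ Γ Δ G} → HLJ'rs ((Γ ⇒ Δ ++ φ₁ ∷ []) ∷ G) → HLJ'rs ((Γ ⇒ Δ ++ φ₁ ∨̇ φ₂ ∷ []) ∷ G)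
  ∨r₂   : ∀ {φ₁ φ₂ Γ Δ G} → HLJ'rs ((Γ ⇒ Δ ++ φ₂ ∷ []) ∷ G) → HLJ'rs ((Γ ⇒ Δ ++ φ₁ ∨̇ φ₂ ∷ []) ∷ G)
  ⇒l    : ∀ {φ ψ Γ Δ G} → HLJ'rs ((Γ ⇒ Δ ++ φ ∷ []) ∷ G) → HLJ'rs ((ψ ∷ Γ ⇒ Δ) ∷ G)
                        → HLJ'rs ((φ ⇒̇ ψ ∷ Γ ⇒ Δ) ∷ G)
  ⇒r'   : ∀ {φ ψ Γ G} → HLJ'rs ((φ ∷ Γ ⇒ ψ ∷ []) ∷ G) → HLJ'rs ((Γ ⇒ φ ⇒̇ ψ ∷ []) ∷ G)
  rs    : ∀ {Γ Δ₁ Δ₂ G} → HLJ'rs ((Γ ⇒ Δ₁ ++ Δ₂) ∷ G) → HLJ'rs ((Γ ⇒ Δ₁) ∷ (Γ ⇒ Δ₂) ∷ G)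

-- Variables are de Bruijn indices; "x not free in Γ" is expressed by Γ
-- being of the form  map ↑ Γ'  (shift of all free indices by one), and
-- [t/x]φ is  φ [ t ]  (substitution of t for index 0).

record Signature : Set₁ where
  field
    Func   : Set
    fArity : Func → ℕ
    Pred   : Set
    pArity : Pred → ℕ

module FO (L : Signature) where
  open Signature L

  data Term : Set where
    var : ℕ → Term
    fun : (f : Func) → Vec Term (fArity f) → Term

  data Form : Set where
    atom : (p : Pred) → Vec Term (pArity p) → Form
    ⊥̇    : Form
    _∧̇_  : Form → Form → Form
    _∨̇_  : Form → Form → Form
    _⇒̇_  : Form → Form → Form
    ∀̇    : Form → Form
    ∃̇    : Form → Form

  ext : (ℕ → ℕ) → ℕ → ℕ
  ext ρ zero    = zero
  ext ρ (suc n) = suc (ρ n)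

  mutual
    renT : (ℕ → ℕ) → Term → Term
    renT ρ (var n)    = var (ρ n)
    renT ρ (fun f ts) = fun f (renTs ρ ts)

    renTs : ∀ {n} → (ℕ → ℕ) → Vec Term n → Vec Term n
    renTs ρ []ᵥ       = []ᵥ
    renTs ρ (t ∷ᵥ ts) = renT ρ t ∷ᵥ renTs ρ ts

  renF : (ℕ → ℕ) → Form → Form
  renF ρ (atom p ts) = atom p (renTs ρ ts)
  renF ρ ⊥̇           = ⊥̇
  renF ρ (φ ∧̇ ψ)     = renF ρ φ ∧̇ renF ρ ψ
  renF ρ (φ ∨̇ ψ)     = renF ρ φ ∨̇ renF ρ ψ
  renF ρ (φ ⇒̇ ψ)     = renF ρ φ ⇒̇ renF ρ ψ
  renF ρ (∀̇ φ)       = ∀̇ (renF (ext ρ) φ)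
  renF ρ (∃̇ φ)       = ∃̇ (renF (ext ρ) φ)

  ↑ : Form → Form
  ↑ = renF suc

  exts : (ℕ → Term) → ℕ → Term
  exts σ zero    = var zero
  exts σ (suc n) = renT suc (σ n)

  mutual
    subT : (ℕ → Term) → Term → Term
    subT σ (var n)    = σ n
    subT σ (fun f ts) = fun f (subTs σ ts)

    subTs : ∀ {n} → (ℕ → Term) → Vec Term n → Vec Term n
    subTs σ []ᵥ       = []ᵥ
    subTs σ (t ∷ᵥ ts) = subT σ t ∷ᵥ subTs σ ts

  subF : (ℕ → Term) → Form → Form
  subF σ (atom p ts) = atom p (subTs σ ts)
  subF σ ⊥̇           = ⊥̇
  subF σ (φ ∧̇ ψ)     = subF σ φ ∧̇ subF σ ψ
  subF σ (φ ∨̇ ψ)     = subF σ φ ∨̇ subF σ ψ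
  subF σ (φ ⇒̇ ψ)     = subF σ φ ⇒̇ subF σ ψ
  subF σ (∀̇ φ)       = ∀̇ (subF (exts σ) φ)
  subF σ (∃̇ φ)       = ∃̇ (subF (exts σ) φ)

  sub0 : Term → ℕ → Term
  sub0 t zero    = t
  sub0 t (suc n) = var n

  _[_] : Form → Term → Form
  φ [ t ] = subF (sub0 t) φ

  ↑S : Sequent Form → Sequent Form
  ↑S (Γ ⇒ Δ) = map ↑ Γ ⇒ map ↑ Δ

  ↑H : Hyper Form → Hyper Form
  ↑H = map ↑S

  data ⊢ : Hyper Form → Set where
    ax    : ∀ φ → ⊢ ((φ ∷ [] ⇒ φ ∷ []) ∷ [])
    ax⊥   : ∀ φ → ⊢ ((⊥̇ ∷ [] ⇒ φ ∷ []) ∷ [])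
    ew    : ∀ {S G} → ⊢ G → ⊢ (S ∷ G)
    ec    : ∀ {S G} → ⊢ (S ∷ S ∷ G) → ⊢ (S ∷ G)
    ee    : ∀ {G S T H} → ⊢ (G ++ S ∷ T ∷ H) → ⊢ (G ++ T ∷ S ∷ H)
    wl    : ∀ {φ Γ Δ G} → ⊢ ((Γ ⇒ Δ) ∷ G) → ⊢ ((φ ∷ Γ ⇒ Δ) ∷ G)
    wr    : ∀ {ψ Γ Δ G} → ⊢ ((Γ ⇒ Δ) ∷ G) → ⊢ ((Γ ⇒ Δ ++ ψ ∷ []) ∷ G)
    cl    : ∀ {φ Γ Δ G} → ⊢ ((φ ∷ φ ∷ Γ ⇒ Δ) ∷ G) → ⊢ ((φ ∷ Γ ⇒ Δ) ∷ G)
    cr    : ∀ {ψ Γ Δ G} → ⊢ ((Γ ⇒ Δ ++ ψ ∷ ψ ∷ []) ∷ G) → ⊢ ((Γ ⇒ Δ ++ ψ ∷ []) ∷ G)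
    exl   : ∀ {Γ₁ φ ψ Γ₂ Δ G} → ⊢ ((Γ₁ ++ φ ∷ ψ ∷ Γ₂ ⇒ Δ) ∷ G)
                              → ⊢ ((Γ₁ ++ ψ ∷ φ ∷ Γ₂ ⇒ Δ) ∷ G)
    exr   : ∀ {Γ Δ₁ φ ψ Δ₂ G} → ⊢ ((Γ ⇒ Δ₁ ++ φ ∷ ψ ∷ Δ₂) ∷ G)
                              → ⊢ ((Γ ⇒ Δ₁ ++ ψ ∷ φ ∷ Δ₂) ∷ G)
    cut   : ∀ {Γ₀ Δ₀ Γ₁ Δ₁ δ G} → ⊢ ((Γ₀ ⇒ Δ₀ ++ δ ∷ []) ∷ G) → ⊢ ((δ ∷ Γ₁ ⇒ Δ₁) ∷ G)
                                → ⊢ ((Γ₀ ++ Γ₁ ⇒ Δ₀ ++ Δ₁) ∷ G)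
    ∧l₁   : ∀ {φ₁ φ₂ Γ Δ G} → ⊢ ((φ₁ ∷ Γ ⇒ Δ) ∷ G) → ⊢ ((φ₁ ∧̇ φ₂ ∷ Γ ⇒ Δ) ∷ G)
    ∧l₂   : ∀ {φ₁ φ₂ Γ Δ G} → ⊢ ((φ₂ ∷ Γ ⇒ Δ) ∷ G) → ⊢ ((φ₁ ∧̇ φ₂ ∷ Γ ⇒ Δ) ∷ G)
    ∧r    : ∀ {φ₁ φ₂ Γ Δ G} → ⊢ ((Γ ⇒ Δ ++ φ₁ ∷ []) ∷ G) → ⊢ ((Γ ⇒ Δ ++ φ₂ ∷ []) ∷ G)
                            → ⊢ ((Γ ⇒ Δ ++ φ₁ ∧̇ φ₂ ∷ []) ∷ G)
    ∨l    : ∀ {φ₁ φ₂ Γ Δ G} → ⊢ ((φ₁ ∷ Γ ⇒ Δ) ∷ G) → ⊢ ((φ₂ ∷ Γ ⇒ Δ) ∷ G)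
                            → ⊢ ((φ₁ ∨̇ φ₂ ∷ Γ ⇒ Δ) ∷ G)
    ∨r₁   : ∀ {φ₁ φ₂ Γ Δ G} → ⊢ ((Γ ⇒ Δ ++ φ₁ ∷ []) ∷ G) → ⊢ ((Γ ⇒ Δ ++ φ₁ ∨̇ φ₂ ∷ []) ∷ G)
    ∨r₂   : ∀ {φ₁ φ₂ Γ Δ G} → ⊢ ((Γ ⇒ Δ ++ φ₂ ∷ []) ∷ G) → ⊢ ((Γ ⇒ Δ ++ φ₁ ∨̇ φ₂ ∷ []) ∷ G)
    ⇒l    : ∀ {φ ψ Γ Δ G} → ⊢ ((Γ ⇒ Δ ++ φ ∷ []) ∷ G) → ⊢ ((ψ ∷ Γ ⇒ Δ) ∷ G)
                          → ⊢ ((φ ⇒̇ ψ ∷ Γ ⇒ Δ) ∷ G)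
    ⇒r'   : ∀ {φ ψ Γ G} → ⊢ ((φ ∷ Γ ⇒ ψ ∷ []) ∷ G) → ⊢ ((Γ ⇒ φ ⇒̇ ψ ∷ []) ∷ G)
    ∀l    : ∀ {φ t Γ Δ G} → ⊢ ((φ [ t ] ∷ Γ ⇒ Δ) ∷ G) → ⊢ ((∀̇ φ ∷ Γ ⇒ Δ) ∷ G)
    ∀r    : ∀ {φ Γ} → ⊢ ((map ↑ Γ ⇒ φ ∷ []) ∷ []) → ⊢ ((Γ ⇒ ∀̇ φ ∷ []) ∷ [])
    ∃l    : ∀ {φ Γ Δ} → ⊢ ((φ ∷ map ↑ Γ ⇒ map ↑ Δ) ∷ []) → ⊢ ((∃̇ φ ∷ Γ ⇒ Δ) ∷ [])
    ∃r    : ∀ {ψ t Γ Δ G} → ⊢ ((Γ ⇒ Δ ++ ψ [ t ] ∷ []) ∷ G) → ⊢ ((Γ ⇒ Δ ++ ∃̇ ψ ∷ []) ∷ G)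
    -- (∀-R_ms): x not free in the conclusion
    ∀r-ms : ∀ {φ Γ G} → ⊢ ((map ↑ Γ ⇒ φ ∷ []) ∷ ↑H G) → ⊢ ((Γ ⇒ ∀̇ φ ∷ []) ∷ G)
    rs    : ∀ {Γ Δ₁ Δ₂ G} → ⊢ ((Γ ⇒ Δ₁ ++ Δ₂) ∷ G) → ⊢ ((Γ ⇒ Δ₁) ∷ (Γ ⇒ Δ₂) ∷ G)

LIN : PForm → PForm → PForm
LIN φ ψ = (φ ⇒̇ ψ) ∨̇ (ψ ⇒̇ φ)

ACD : (L : Signature) → FO.Form L → FO.Form L → FO.Form L
ACD L φ ψ = ∀̇ (↑ φ ∨̇ ψ) ⇒̇ (φ ∨̇ ∀̇ ψ)
  where open FO L

{-# OPTIONS --safe #-}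
-- With (rs), the classically valid sequent φ ∨ ψ ⇒ φ, ψ splits into the
-- hypersequent φ ∨ ψ ⇒ φ | φ ∨ ψ ⇒ ψ.  For LIN, cutting ψ ⇒ φ ∨ ψ into the
-- first component and φ ⇒ φ ∨ ψ into the second leaves ψ ⇒ φ | φ ⇒ ψ, and
-- →-right, ∨-right and external contraction yield (φ → ψ) ∨ (ψ → φ).  For
-- ACD, split the instance ↑φ ∨ ψ(x) of ∀x(φ ∨ ψ(x)) the same way; x is then
-- free only in the ψ-component, so (∀-R_ms) quantifies it there.
module Submission where

open import Defs
open import Data.Nat using (ℕ; zero; suc)
open import Data.List using ([]; _∷_)
open import Data.Vec using (Vec) renaming ([] to []ᵥ; _∷_ to _∷ᵥ_)
open import Data.Product using (_×_; _,_)
open import Relation.Binary.PropositionalEquality using (_≡_; refl; cong; cong₂; sym; subst)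

module Propositional where

  swap : ∀ {S T G} → HLJ'rs (S ∷ T ∷ G) → HLJ'rs (T ∷ S ∷ G)
  swap = ee {G = []}

  ew* : ∀ {S} G → HLJ'rs (S ∷ []) → HLJ'rs (S ∷ G)
  ew* []      d = d
  ew* (T ∷ G) d = swap (ew (ew* G d))

  ∨l-inv₁ : ∀ {φ₁ φ₂ Γ Δ G} → HLJ'rs ((φ₁ ∨̇ φ₂ ∷ Γ ⇒ Δ) ∷ G) → HLJ'rs ((φ₁ ∷ Γ ⇒ Δ) ∷ G)
  ∨l-inv₁ {φ₁} {G = G} = cut {Γ₀ = φ₁ ∷ []} {Δ₀ = []} (∨r₁ {Δ = []} (ew* G (ax φ₁)))

  ∨l-inv₂ : ∀ {φ₁ φ₂ Γ Δ G} → HLJ'rs ((φ₁ ∨̇ φ₂ ∷ Γ ⇒ Δ) ∷ G) → HLJ'rs ((φ₂ ∷ Γ ⇒ Δ) ∷ G)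
  ∨l-inv₂ {φ₂ = φ₂} {G = G} = cut {Γ₀ = φ₂ ∷ []} {Δ₀ = []} (∨r₂ {Δ = []} (ew* G (ax φ₂)))

  ∨r-merge : ∀ {α β Γ G} → HLJ'rs ((Γ ⇒ α ∷ []) ∷ (Γ ⇒ β ∷ []) ∷ G)
           → HLJ'rs ((Γ ⇒ α ∨̇ β ∷ []) ∷ G)
  ∨r-merge d = ec (swap (∨r₂ {Δ = []} (swap (∨r₁ {Δ = []} d))))

  ∨-split : ∀ φ ψ → HLJ'rs ((φ ∨̇ ψ ∷ [] ⇒ φ ∷ []) ∷ (φ ∨̇ ψ ∷ [] ⇒ ψ ∷ []) ∷ [])
  ∨-split φ ψ = rs {Δ₁ = φ ∷ []} (∨l (wr (ax φ)) (exr {Δ₁ = []} (wr (ax ψ))))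

  HLJ'rs-LIN : (φ ψ : PForm) → HLJ'rs (([] ⇒ LIN φ ψ ∷ []) ∷ [])
  HLJ'rs-LIN φ ψ = ∨r-merge (⇒r' (∨l-inv₁ (swap (⇒r' (∨l-inv₂ (∨-split φ ψ))))))

module FirstOrder (L : Signature) where
  open FO L

  module _ {ρ : ℕ → ℕ} {σ : ℕ → Term} (σ∘ρ≗var : ∀ n → σ (ρ n) ≡ var n) where
    mutual
      subT-renT-cancel : ∀ t → subT σ (renT ρ t) ≡ t
      subT-renT-cancel (var n)    = σ∘ρ≗var n
      subT-renT-cancel (fun f ts) = cong (fun f) (subTs-renTs-cancel ts)

      subTs-renTs-cancel : ∀ {k} (ts : Vec Term k) → subTs σ (renTs ρ ts) ≡ ts
      subTs-renTs-cancel []ᵥ       = refl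
      subTs-renTs-cancel (t ∷ᵥ ts) = cong₂ _∷ᵥ_ (subT-renT-cancel t) (subTs-renTs-cancel ts)

    exts∘ext≗var : ∀ n → exts σ (ext ρ n) ≡ var n
    exts∘ext≗var zero    = refl
    exts∘ext≗var (suc n) = cong (renT suc) (σ∘ρ≗var n)

  subF-renF-cancel : ∀ {ρ σ} → (∀ n → σ (ρ n) ≡ var n) → ∀ χ → subF σ (renF ρ χ) ≡ χ
  subF-renF-cancel h (atom p ts) = cong (atom p) (subTs-renTs-cancel h ts)
  subF-renF-cancel h ⊥̇           = refl
  subF-renF-cancel h (a ∧̇ b)     = cong₂ _∧̇_ (subF-renF-cancel h a) (subF-renF-cancel h b)
  subF-renF-cancel h (a ∨̇ b)     = cong₂ _∨̇_ (subF-renF-cancel h a) (subF-renF-cancel h b)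
  subF-renF-cancel h (a ⇒̇ b)     = cong₂ _⇒̇_ (subF-renF-cancel h a) (subF-renF-cancel h b)
  subF-renF-cancel h (∀̇ a)       = cong ∀̇ (subF-renF-cancel (exts∘ext≗var h) a)
  subF-renF-cancel h (∃̇ a)       = cong ∃̇ (subF-renF-cancel (exts∘ext≗var h) a)

  -- The body of ↑ (∀̇ χ) is renF (ext suc) χ; instantiating it with x recovers χ.
  instantiate-shifted-body : ∀ χ → renF (ext suc) χ [ var 0 ] ≡ χ
  instantiate-shifted-body = subF-renF-cancel sub0-ext
    where
    sub0-ext : ∀ n → sub0 (var 0) (ext suc n) ≡ var n
    sub0-ext zero    = refl
    sub0-ext (suc n) = refl

  swap : ∀ {S T G} → ⊢ (S ∷ T ∷ G) → ⊢ (T ∷ S ∷ G)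
  swap = ee {G = []}

  ∨r-merge : ∀ {α β Γ G} → ⊢ ((Γ ⇒ α ∷ []) ∷ (Γ ⇒ β ∷ []) ∷ G) → ⊢ ((Γ ⇒ α ∨̇ β ∷ []) ∷ G)
  ∨r-merge d = ec (swap (∨r₂ {Δ = []} (swap (∨r₁ {Δ = []} d))))

  ∀l-fresh : ∀ {χ Γ Δ G} → ⊢ ((χ ∷ Γ ⇒ Δ) ∷ G) → ⊢ ((↑ (∀̇ χ) ∷ Γ ⇒ Δ) ∷ G)
  ∀l-fresh {χ} {Γ} {Δ} {G} d =
    ∀l {t = var 0} (subst (λ X → ⊢ ((X ∷ Γ ⇒ Δ) ∷ G)) (sym (instantiate-shifted-body χ)) d)

  ∀-∨-split : ∀ φ ψ → ⊢ ((↑ (∀̇ (↑ φ ∨̇ ψ)) ∷ [] ⇒ ψ ∷ []) ∷ (↑ (∀̇ (↑ φ ∨̇ ψ)) ∷ [] ⇒ ↑ φ ∷ []) ∷ [])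
  ∀-∨-split φ ψ = rs {Δ₁ = ψ ∷ []} (∀l-fresh (∨l (exr {Δ₁ = []} (wr (ax (↑ φ)))) (wr (ax ψ))))

  ⊢-ACD : (φ ψ : Form) → ⊢ (([] ⇒ ACD L φ ψ ∷ []) ∷ [])
  ⊢-ACD φ ψ = ⇒r' (∨r-merge (swap (∀r-ms (∀-∨-split φ ψ))))

mainTheorem1 : ((φ ψ : PForm) → HLJ'rs (([] ⇒ LIN φ ψ ∷ []) ∷ []))
    × ((L : Signature) (φ ψ : FO.Form L) → FO.⊢ L (([] ⇒ ACD L φ ψ ∷ []) ∷ []))
mainTheorem1 = Propositional.HLJ'rs-LIN , λ L → FirstOrder.⊢-ACD L
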